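{- Let $\Delta$ be a simplicial complex on $V=\{x_1,\dots,x_n\}$ and let $\chi$ be the $n$-colouring $V=\{x_1\}\cup\cdots\cup\{x_n\}$, with associated new vertices $y_1,\dots,y_n$. Then: (1) every facet $G$ of $\Delta_\chi$ has the form $G=\{z_1,\dots,z_n\}$ with $z_i\in\{x_i,y_i\}$ for $i=1,\dots,n$; (2) if $\Delta=\operatorname{Ind}(\Gamma)$ for some simplicial complex $\Gamma$ on $V$, then $\Delta_\chi$ is the independence complex of the whiskering of $\Gamma$ (the complex $\Gamma\cup\langle\{x_1,y_1\},\dots,\{x_n,y_n\}\rangle$); in other words $\mathcal{N}(\Delta_\chi)=\mathcal{N}(\Delta)+(x_1y_1,\dots,x_ny_n)$.
   Context: An $s$-colouring $\chi$ of a simplicial complex $\Delta$ on $V$ is a partition $V=V_1\cup\cdots\cup V_s$ (some $V_i$ may be empty) with $|V_i\cap F|\le1$ for every $i$ and every facet $F$. Given $\chi$, $\Delta_\chi$ is the complex on $V\cup\{y_1,\dots,y_s\}$ whose faces are the sets $F\cup G$ with $F\in\Delta$ and $G\subseteq Y_F=\{y_j: F\cap V_j=\emptyset\}$; equivalently $\Delta_\chi=\langle F\cup Y_F: F\in\Delta\rangle$. $\operatorname{Ind}(\Gamma)$ is the complex of subsets of vertices containing no facet of $\Gamma$. $\mathcal{N}(\cdot)$ is the Stanley–Reisner ideal (generated by products of vertices of non-faces) in the polynomial ring on the vertices. -}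

module Defs where

open import Data.Nat using (ℕ; _+_)
open import Data.Fin using (Fin; _↑ˡ_; _↑ʳ_)
open import Data.Fin.Subset using (Subset; _∈_; _∉_; _⊆_; _∪_; ⁅_⁆; ⊥)
open import Data.Vec using (_++_; replicate)
open import Data.Bool using (false)
open import Data.Product using (Σ; _×_; ∃; ∃-syntax)
open import Data.Sum using (_⊎_)
open import Relation.Binary.PropositionalEquality using (_≡_; _≢_)
open import Relation.Nullary using (¬_)

Complex : ℕ → Set₁
Complex m = Subset m → Set

IsSimplicialComplex : ∀ {m} → Complex m → Set
IsSimplicialComplex {m} Δ =
  Δ ⊥ × (∀ F G → G ⊆ F → Δ F → Δ G) × (∀ (i : Fin m) → Δ ⁅ i ⁆)

IsFacet : ∀ {m} → Complex m → Subset m → Set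
IsFacet Δ F = Δ F × (∀ G → Δ G → F ⊆ G → G ≡ F)

Ind : ∀ {m} → Complex m → Complex m
Ind Γ S = ¬ (∃[ F ] (IsFacet Γ F × F ⊆ S))

IsColouring : ∀ {n s} → Complex n → (Fin n → Fin s) → Set
IsColouring Δ χ = ∀ F → IsFacet Δ F → ∀ u v → u ∈ F → v ∈ F → χ u ≡ χ v → u ≡ v

-- Δ_χ on the vertex set Fin (n + s): vertex x_i is  i ↑ˡ s,
-- new vertex y_j is  n ↑ʳ j.  A subset of Fin (n + s) is written F ++ G
-- with F ⊆ V and G ⊆ Y.  Faces: F ∪ G with F ∈ Δ and G ⊆ Y_F.
Colour : ∀ {n s} → Complex n → (Fin n → Fin s) → Complex (n + s)
Colour {n} {s} Δ χ S =
  Σ (Subset n) λ F → Σ (Subset s) λ G →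
    (S ≡ F ++ G) × Δ F × (∀ j → j ∈ G → ∀ v → v ∈ F → χ v ≢ j)

singletonColouring : ∀ {n} → Fin n → Fin n
singletonColouring i = i

Whisker : ∀ {n} → Complex n → Complex (n + n)
Whisker {n} Γ S =
  (∃[ F ] (Γ F × S ≡ F ++ replicate n false))
  ⊎ (∃[ i ] (S ⊆ (⁅ i ↑ˡ n ⁆ ∪ ⁅ n ↑ʳ i ⁆)))

-- Over the colouring by singletons, y_i may join a face F of Δ exactly when x_i ∉ F, so the
-- faces of Δ_χ are the sets A ∪ B with A ∈ Δ and A ∩ B = ∅, and a facet contains exactly one of
-- x_i, y_i for every i. The facets of the whiskering of Γ are the facets of Γ and the whiskers
-- {x_i, y_i} (a facet of Γ cannot lie in a singleton, as singletons are faces of Δ = Ind Γ);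
-- so A ∪ B avoids them all exactly when A ∈ Ind Γ and A ∩ B = ∅.
module Submission where

open import Defs
open import Data.Nat using (ℕ; _+_)
open import Data.Fin as Fin using (Fin; _↑ˡ_; _↑ʳ_)
open import Data.Fin.Subset using (Subset; _∈_; _∉_; _⊆_; _∪_; _∩_; ⁅_⁆; ⊥; Empty)
open import Data.Fin.Subset.Properties
  using (_∈?_; ⊆-antisym; ∉⊥; ⊥⊆; x∈⁅x⁆; x∈⁅y⁆⇒x≡y; p⊆p∪q; q⊆p∪q; x∈p∪q⁻; x∈p∩q⁺; x∈p∩q⁻)
open import Data.Fin.Properties
  using (↑ˡ-injective; splitAt-↑ˡ; splitAt-↑ʳ; splitAt⁻¹-↑ˡ; splitAt⁻¹-↑ʳ)
open import Data.Vec using (_++_; splitAt)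
open import Data.Vec.Properties
  using (++-injectiveˡ; ++-injectiveʳ; lookup-++ˡ; lookup-++ʳ; []=⇒lookup; lookup⇒[]=)
open import Data.Product using (_×_; _,_; proj₂; ∃-syntax)
import Data.Product as Product
open import Data.Product.Function.NonDependent.Propositional using (_×-⇔_)
open import Data.Sum using (_⊎_; inj₁; inj₂)
import Data.Sum as Sum
open import Data.Empty using (⊥-elim)
open import Function using (_∘_; id)
open import Function.Bundles using (_⇔_; mk⇔; Equivalence)
import Function.Properties.Equivalence as ⇔
open import Relation.Nullary using (yes; no)
open import Relation.Binary.PropositionalEquality using (_≡_; _≢_; refl; sym; trans; cong; subst)

module _ {m n : ℕ} {A : Subset m} {B : Subset n} where

  ∈-++⁺ˡ : ∀ {i} → i ∈ A → (i ↑ˡ n) ∈ A ++ B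
  ∈-++⁺ˡ {i} i∈A =
    lookup⇒[]= (i ↑ˡ n) (A ++ B) (trans (lookup-++ˡ A B i) ([]=⇒lookup i∈A))

  ∈-++⁻ˡ : ∀ {i} → (i ↑ˡ n) ∈ A ++ B → i ∈ A
  ∈-++⁻ˡ {i} i∈A++B =
    lookup⇒[]= i A (trans (sym (lookup-++ˡ A B i)) ([]=⇒lookup i∈A++B))

  ∈-++⁺ʳ : ∀ {j} → j ∈ B → (m ↑ʳ j) ∈ A ++ B
  ∈-++⁺ʳ {j} j∈B =
    lookup⇒[]= (m ↑ʳ j) (A ++ B) (trans (lookup-++ʳ A B j) ([]=⇒lookup j∈B))

  ∈-++⁻ʳ : ∀ {j} → (m ↑ʳ j) ∈ A ++ B → j ∈ B
  ∈-++⁻ʳ {j} j∈A++B =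
    lookup⇒[]= j B (trans (sym (lookup-++ʳ A B j)) ([]=⇒lookup j∈A++B))

module _ {m n : ℕ} {A C : Subset m} {B D : Subset n} where

  ++-mono-⊆ : A ⊆ C → B ⊆ D → A ++ B ⊆ C ++ D
  ++-mono-⊆ A⊆C B⊆D {x} x∈A++B with Fin.splitAt m x in eq
  ... | inj₁ i rewrite sym (splitAt⁻¹-↑ˡ eq) = ∈-++⁺ˡ (A⊆C (∈-++⁻ˡ x∈A++B))
  ... | inj₂ j rewrite sym (splitAt⁻¹-↑ʳ eq) = ∈-++⁺ʳ (B⊆D (∈-++⁻ʳ x∈A++B))

  ++-⊆⁻ˡ : A ++ B ⊆ C ++ D → A ⊆ C
  ++-⊆⁻ˡ A++B⊆C++D = ∈-++⁻ˡ ∘ A++B⊆C++D ∘ ∈-++⁺ˡ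

↑ˡ≢↑ʳ : ∀ {m n} (i : Fin m) (j : Fin n) → i ↑ˡ n ≢ m ↑ʳ j
↑ˡ≢↑ʳ {m} {n} i j eq
  with trans (sym (splitAt-↑ˡ m i n)) (trans (cong (Fin.splitAt m) eq) (splitAt-↑ʳ m n j))
... | ()

Empty-∩-∪⁅⁆ : ∀ {n} {A B : Subset n} {i} → Empty (A ∩ B) → i ∉ A → Empty (A ∩ (B ∪ ⁅ i ⁆))
Empty-∩-∪⁅⁆ {A = A} {B} {i} A∩B-empty i∉A (j , j∈A∩[B∪i]) with x∈p∩q⁻ A _ j∈A∩[B∪i]
... | j∈A , j∈B∪i with x∈p∪q⁻ B ⁅ i ⁆ j∈B∪i
...   | inj₁ j∈B = A∩B-empty (j , x∈p∩q⁺ (j∈A , j∈B))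
...   | inj₂ j∈i = i∉A (subst (_∈ A) (x∈⁅y⁆⇒x≡y i j∈i) j∈A)

Colour-singleton-++⇔ : ∀ {n} {Δ : Complex n} (A B : Subset n) →
  Colour Δ singletonColouring (A ++ B) ⇔ (Δ A × Empty (A ∩ B))
Colour-singleton-++⇔ {Δ = Δ} A B = mk⇔ to from
  where
  to : Colour Δ singletonColouring (A ++ B) → Δ A × Empty (A ∩ B)
  to (F , G , eq , ΔF , G-avoids-F)
    rewrite ++-injectiveˡ A F eq | ++-injectiveʳ A F eq =
      ΔF , λ (i , i∈F∩G) → let i∈F , i∈G = x∈p∩q⁻ F G i∈F∩G in G-avoids-F i i∈G i i∈F refl

  from : Δ A × Empty (A ∩ B) → Colour Δ singletonColouring (A ++ B)
  from (ΔA , A∩B-empty) =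
    A , B , refl , ΔA , λ { j j∈B .j j∈A refl → A∩B-empty (j , x∈p∩q⁺ (j∈A , j∈B)) }

Colour-singleton-facet-complement : ∀ {n} {Δ : Complex n} (A B : Subset n) →
  IsFacet (Colour Δ singletonColouring) (A ++ B) → ∀ i → i ∉ A → i ∈ B
Colour-singleton-facet-complement A B (face , maximal) i i∉A
  with Equivalence.to (Colour-singleton-++⇔ A B) face
... | ΔA , A∩B-empty = subst (i ∈_) B∪i≡B (q⊆p∪q B ⁅ i ⁆ (x∈⁅x⁆ i))
  where
  B∪i≡B : B ∪ ⁅ i ⁆ ≡ B
  B∪i≡B = ++-injectiveʳ A A (maximal (A ++ (B ∪ ⁅ i ⁆))
    (Equivalence.from (Colour-singleton-++⇔ A (B ∪ ⁅ i ⁆)) (ΔA , Empty-∩-∪⁅⁆ A∩B-empty i∉A))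
    (++-mono-⊆ {A = A} {C = A} id (p⊆p∪q ⁅ i ⁆)))

Colour-singleton-facet-split : ∀ {n} {Δ : Complex n} (A B : Subset n) →
  IsFacet (Colour Δ singletonColouring) (A ++ B) →
  ∀ i → (i ∈ A × i ∉ B) ⊎ (i ∉ A × i ∈ B)
Colour-singleton-facet-split A B facet@(face , _) i with i ∈? A
... | yes i∈A = inj₁ (i∈A , λ i∈B → A∩B-empty (i , x∈p∩q⁺ (i∈A , i∈B)))
  where A∩B-empty = proj₂ (Equivalence.to (Colour-singleton-++⇔ A B) face)
... | no i∉A = inj₂ (i∉A , Colour-singleton-facet-complement A B facet i i∉A)

whisker : ∀ {n} → Fin n → Subset (n + n)
whisker {n} i = ⁅ i ↑ˡ n ⁆ ∪ ⁅ n ↑ʳ i ⁆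

module _ {n : ℕ} (i : Fin n) where

  ↑ˡ∈whisker : (i ↑ˡ n) ∈ whisker i
  ↑ˡ∈whisker = p⊆p∪q ⁅ n ↑ʳ i ⁆ (x∈⁅x⁆ (i ↑ˡ n))

  ↑ʳ∈whisker : (n ↑ʳ i) ∈ whisker i
  ↑ʳ∈whisker = q⊆p∪q ⁅ i ↑ˡ n ⁆ ⁅ n ↑ʳ i ⁆ (x∈⁅x⁆ (n ↑ʳ i))

  ↑ˡ∈whisker⇒≡ : ∀ {v} → (v ↑ˡ n) ∈ whisker i → v ≡ i
  ↑ˡ∈whisker⇒≡ {v} v∈whisker with x∈p∪q⁻ ⁅ i ↑ˡ n ⁆ ⁅ n ↑ʳ i ⁆ v∈whisker
  ... | inj₁ v∈xᵢ = ↑ˡ-injective n v i (x∈⁅y⁆⇒x≡y _ v∈xᵢ)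
  ... | inj₂ v∈yᵢ = ⊥-elim (↑ˡ≢↑ʳ v i (x∈⁅y⁆⇒x≡y _ v∈yᵢ))

  whisker-⊆ : ∀ {A B : Subset n} → i ∈ A → i ∈ B → whisker i ⊆ A ++ B
  whisker-⊆ {A} {B} i∈A i∈B x∈whisker with x∈p∪q⁻ ⁅ i ↑ˡ n ⁆ ⁅ n ↑ʳ i ⁆ x∈whisker
  ... | inj₁ x∈xᵢ = subst (_∈ A ++ B) (sym (x∈⁅y⁆⇒x≡y _ x∈xᵢ)) (∈-++⁺ˡ i∈A)
  ... | inj₂ x∈yᵢ = subst (_∈ A ++ B) (sym (x∈⁅y⁆⇒x≡y _ x∈yᵢ)) (∈-++⁺ʳ i∈B)

whisker-isFacet : ∀ {n} {Γ : Complex n} i → IsFacet (Whisker Γ) (whisker i)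
whisker-isFacet {Γ = Γ} i = inj₂ (i , id) , maximal
  where
  maximal : ∀ K → Whisker Γ K → whisker i ⊆ K → K ≡ whisker i
  maximal .(F ++ ⊥) (inj₁ (F , _ , refl)) whisker⊆K =
    ⊥-elim (∉⊥ (∈-++⁻ʳ {A = F} (whisker⊆K (↑ʳ∈whisker i))))
  maximal K (inj₂ (j , K⊆whiskerⱼ)) whisker⊆K
    with ↑ˡ∈whisker⇒≡ j (K⊆whiskerⱼ (whisker⊆K (↑ˡ∈whisker i)))
  ... | refl = ⊆-antisym K⊆whiskerⱼ whisker⊆K

Whisker-facet-cases : ∀ {n} {Γ : Complex n} {H} → IsFacet (Whisker Γ) H →
  (∃[ F ] (IsFacet Γ F × H ≡ F ++ ⊥)) ⊎ (∃[ i ] (H ≡ whisker i))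
Whisker-facet-cases {Γ = Γ} (inj₁ (F , ΓF , refl) , maximal) = inj₁ (F , (ΓF , maximalΓ) , refl)
  where
  maximalΓ : ∀ G → Γ G → F ⊆ G → G ≡ F
  maximalΓ G ΓG F⊆G = ++-injectiveˡ G F (maximal (G ++ ⊥) (inj₁ (G , ΓG , refl)) (++-mono-⊆ F⊆G id))
Whisker-facet-cases (inj₂ (i , H⊆whisker) , maximal) =
  inj₂ (i , sym (maximal (whisker i) (inj₂ (i , id)) H⊆whisker))

module _ {n : ℕ} {Γ : Complex n} (vertex-independent : ∀ i → Ind Γ ⁅ i ⁆) where

  Whisker-facet-++⊥ : ∀ {F} → IsFacet Γ F → IsFacet (Whisker Γ) (F ++ ⊥)
  Whisker-facet-++⊥ {F} facet@(ΓF , maximal) = inj₁ (F , ΓF , refl) , maximal′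
    where
    maximal′ : ∀ K → Whisker Γ K → F ++ ⊥ ⊆ K → K ≡ F ++ ⊥
    maximal′ .(G ++ ⊥) (inj₁ (G , ΓG , refl)) F++⊥⊆G++⊥ =
      cong (_++ ⊥) (maximal G ΓG (++-⊆⁻ˡ F++⊥⊆G++⊥))
    maximal′ K (inj₂ (i , K⊆whisker)) F++⊥⊆K = ⊥-elim (vertex-independent i (F , facet , F⊆⁅i⁆))
      where
      F⊆⁅i⁆ : F ⊆ ⁅ i ⁆
      F⊆⁅i⁆ v∈F = subst (_∈ ⁅ i ⁆) (sym (↑ˡ∈whisker⇒≡ i (K⊆whisker (F++⊥⊆K (∈-++⁺ˡ v∈F)))))
                        (x∈⁅x⁆ i)

  Ind-Whisker-++⇔ : (A B : Subset n) → Ind (Whisker Γ) (A ++ B) ⇔ (Ind Γ A × Empty (A ∩ B))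
  Ind-Whisker-++⇔ A B = mk⇔ to from
    where
    to : Ind (Whisker Γ) (A ++ B) → Ind Γ A × Empty (A ∩ B)
    to ind = (λ (F , facet , F⊆A) → ind (F ++ ⊥ , Whisker-facet-++⊥ facet , ++-mono-⊆ F⊆A ⊥⊆))
           , (λ (i , i∈A∩B) → let i∈A , i∈B = x∈p∩q⁻ A B i∈A∩B in
                                ind (whisker i , whisker-isFacet i , whisker-⊆ i i∈A i∈B))

    from : Ind Γ A × Empty (A ∩ B) → Ind (Whisker Γ) (A ++ B)
    from (indA , A∩B-empty) (H , facet , H⊆A++B) with Whisker-facet-cases facet
    ... | inj₁ (F , facetΓ , refl) = indA (F , facetΓ , ++-⊆⁻ˡ H⊆A++B)
    ... | inj₂ (i , refl) = A∩B-empty (i , x∈p∩q⁺ (∈-++⁻ˡ (H⊆A++B (↑ˡ∈whisker i)) ,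
                                                   ∈-++⁻ʳ (H⊆A++B (↑ʳ∈whisker i))))

proposition4p4 : (n : ℕ) (Δ : Complex n) → IsSimplicialComplex Δ →
    ((G : Subset (n + n)) → IsFacet (Colour Δ singletonColouring) G →
      (i : Fin n) →
        ((i ↑ˡ n) ∈ G × (n ↑ʳ i) ∉ G) ⊎ ((i ↑ˡ n) ∉ G × (n ↑ʳ i) ∈ G))
    × ((Γ : Complex n) → IsSimplicialComplex Γ →
      ((F : Subset n) → Δ F ⇔ Ind Γ F) →
      (S : Subset (n + n)) →
        Colour Δ singletonColouring S ⇔ Ind (Whisker Γ) S)
proposition4p4 n Δ (_ , _ , Δ-vertex) = facet-split , Colour⇔Ind-Whisker
  where
  facet-split : (G : Subset (n + n)) → IsFacet (Colour Δ singletonColouring) G → (i : Fin n) →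
    ((i ↑ˡ n) ∈ G × (n ↑ʳ i) ∉ G) ⊎ ((i ↑ˡ n) ∉ G × (n ↑ʳ i) ∈ G)
  facet-split G facet i with splitAt n G
  ... | A , B , refl =
    Sum.map (Product.map (∈-++⁺ˡ {B = B}) (_∘ ∈-++⁻ʳ {A = A}))
            (Product.map (_∘ ∈-++⁻ˡ {B = B}) (∈-++⁺ʳ {A = A}))
            (Colour-singleton-facet-split A B facet i)

  Colour⇔Ind-Whisker : (Γ : Complex n) → IsSimplicialComplex Γ →
    ((F : Subset n) → Δ F ⇔ Ind Γ F) →
    (S : Subset (n + n)) → Colour Δ singletonColouring S ⇔ Ind (Whisker Γ) S
  Colour⇔Ind-Whisker Γ _ Δ⇔IndΓ S with splitAt n S
  ... | A , B , refl = ⇔.trans (Colour-singleton-++⇔ A B)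
                        (⇔.trans (Δ⇔IndΓ A ×-⇔ ⇔.refl) (⇔.sym (Ind-Whisker-++⇔ vertex-independent A B)))
    where
    vertex-independent : ∀ i → Ind Γ ⁅ i ⁆
    vertex-independent i = Equivalence.to (Δ⇔IndΓ ⁅ i ⁆) (Δ-vertex i)
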